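{- Let $S$ be a finite transformation semigroup which is a band, let $I$ be its minimal ideal, and let $b_1,\dots,b_s$ generate $I$ as a semigroup. Then $\mathrm{Gr}(S)=\mathrm{Gr}(\{b_1,\dots,b_s\})$.
   Context: A band is a semigroup in which every element is idempotent. The minimal ideal is the unique minimal two-sided ideal. Transformations act on the right. For a set $M$ of transformations of a finite set $V$, $\mathrm{Gr}(M)$ is the graph on $V$ in which distinct $v,w$ are adjacent iff there is no $f\in M$ with $vf=wf$. -}

module Defs where

open import Level using (Level; suc; zero)
open import Data.Nat using (ℕ)
open import Data.Fin using (Fin)
open import Data.List using (List)
open import Data.List.Relation.Unary.Any using (Any)
open import Data.List.Membership.Propositional using (_∈_)
open import Data.Product using (Σ; ∃; _×_)
open import Relation.Binary.PropositionalEquality using (_≡_; _≢_)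
open import Relation.Nullary using (¬_)

Transformation : ℕ → Set
Transformation n = Fin n → Fin n

-- Transformations act on the right: v (f ⨾ g) = (v f) g.
_⨾_ : ∀ {n} → Transformation n → Transformation n → Transformation n
(f ⨾ g) v = g (f v)

_≈_ : ∀ {n} → Transformation n → Transformation n → Set
f ≈ g = ∀ v → f v ≡ g v

InS : ∀ {n} → List (Transformation n) → Transformation n → Set
InS S f = Any (f ≈_) S

IsTransformationSemigroup : ∀ {n} → List (Transformation n) → Set
IsTransformationSemigroup S = ∀ f g → InS S f → InS S g → InS S (f ⨾ g)

IsBand : ∀ {n} → List (Transformation n) → Set
IsBand S = ∀ f → InS S f → (f ⨾ f) ≈ f

record IsIdeal {n} (S : List (Transformation n)) (J : Transformation n → Set) : Set where
  field
    respects  : ∀ f g → f ≈ g → J f → J g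
    subset    : ∀ f → J f → InS S f
    nonempty  : ∃ J
    closedˡ   : ∀ s f → InS S s → J f → J (s ⨾ f)
    closedʳ   : ∀ f s → J f → InS S s → J (f ⨾ s)

record IsMinimalIdeal {n} (S : List (Transformation n)) (I : Transformation n → Set) : Set₁ where
  field
    ideal   : IsIdeal S I
    minimal : ∀ (J : Transformation n → Set) → IsIdeal S J → ∀ f → I f → J f

data Generated {n} (bs : List (Transformation n)) : Transformation n → Set where
  gen  : ∀ {f} → f ∈ bs → Generated bs f
  comp : ∀ {f g} → Generated bs f → Generated bs g → Generated bs (f ⨾ g)
  resp : ∀ {f g} → f ≈ g → Generated bs f → Generated bs g

GrAdj : ∀ {n} → (Transformation n → Set) → Fin n → Fin n → Set
GrAdj {n} M v w = v ≢ w × ¬ (Σ (Transformation n) λ f → M f × f v ≡ f w)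

-- Since bs ⊆ I ⊆ S, an element of bs collapsing v and w is in particular
-- an element of S doing so; the content is the converse.  The argument:
--   * in a band, (x c y) c (x c y) = x c y  (band-sandwich);
--   * for c ∈ S the set S c S is an ideal, so by minimality every b ∈ I
--     has the form b = s c t  (minimal⊆principal);
--   * hence I is "rectangular": b r b = b for b ∈ I, r ∈ S
--     (take c = b r b and apply band-sandwich to b = s c t);
--   * therefore, for b ∈ I and r ∈ S, b and b r have the same kernel
--     (kernel-of-minimal), and by induction on generation every element
--     of I collapsing v, w has a generator collapsing v, w (collapse);
--   * if f ∈ S collapses v, w then so does f e ∈ I for any e ∈ I.
module Submission where

open import Defs
open import Data.Nat using (ℕ)
open import Data.Fin using (Fin)
open import Data.List using (List)
open import Data.List.Membership.Propositional using (_∈_)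
open import Function.Bundles using (_⇔_; mk⇔; Equivalence)
open import Data.List.Relation.Unary.Any as Any using ()
open import Data.Product using (Σ; _×_; _,_; proj₁; proj₂)
open import Relation.Binary.PropositionalEquality

module BandFacts {n : ℕ} (S : List (Transformation n))
                 (closed : IsTransformationSemigroup S) (band : IsBand S) where

  T : Set
  T = Transformation n

  inS-resp : ∀ {f g} → f ≈ g → InS S f → InS S g
  inS-resp e = Any.map (λ p v → trans (sym (e v)) (p v))

  -- A band identity: (x c y) c (x c y) = x c y, using idempotence of
  -- x c and of c x c y.
  band-sandwich : ∀ x c y → InS S x → InS S c → InS S y →
                  ((((x ⨾ c) ⨾ y) ⨾ c) ⨾ ((x ⨾ c) ⨾ y)) ≈ ((x ⨾ c) ⨾ y)
  band-sandwich x c y xS cS yS z =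
    begin
      y (c (x (c (y (c (x z))))))
    ≡⟨ cong (λ u → y (c (x (c (y u))))) (sym (band (x ⨾ c) xcS z)) ⟩
      y (c (x (c (y (c (x (c (x z))))))))
    ≡⟨ band (((c ⨾ x) ⨾ c) ⨾ y) cxcyS (x z) ⟩
      y (c (x (c (x z))))
    ≡⟨ cong y (band (x ⨾ c) xcS z) ⟩
      y (c (x z))
    ∎
    where
      open ≡-Reasoning
      xcS = closed x c xS cS
      cxcyS = closed _ y (closed _ c (closed c x cS xS) cS) yS

  Principal : T → T → Set
  Principal c f = InS S f × Σ T λ s → Σ T λ t →
                  InS S s × InS S t × (((s ⨾ c) ⨾ t) ≈ f)

  -- S c S is an ideal; it is nonempty since c = c c c in a band.
  principal-ideal : ∀ c → InS S c → IsIdeal S (Principal c)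
  principal-ideal c cS = record
    { respects = λ f g e (fS , s , t , sS , tS , q) →
        inS-resp e fS , s , t , sS , tS , (λ v → trans (q v) (e v))
    ; subset   = λ f p → proj₁ p
    ; nonempty = c , cS , c , c , cS , cS ,
        (λ v → trans (band c cS (c v)) (band c cS v))
    ; closedˡ  = λ s' f s'S (fS , s , t , sS , tS , q) →
        closed s' f s'S fS , s' ⨾ s , t , closed s' s s'S sS , tS , (λ v → q (s' v))
    ; closedʳ  = λ f s' (fS , s , t , sS , tS , q) s'S →
        closed f s' fS s'S , s , t ⨾ s' , sS , closed t s' tS s'S , (λ v → cong s' (q v))
    }

  module MinimalIdeal (I : T → Set) (minimalIdeal : IsMinimalIdeal S I) where
    open IsMinimalIdeal minimalIdeal
    open IsIdeal ideal

    minimal⊆principal : ∀ c → InS S c → ∀ b → I b → Principal c b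
    minimal⊆principal c cS = minimal (Principal c) (principal-ideal c cS)

    rectangular : ∀ b r → I b → InS S r → ((b ⨾ r) ⨾ b) ≈ b
    rectangular b r Ib rS z =
      begin
        b (r (b z))
      ≡⟨ cong (λ u → b (r u)) (sym (band b bS z)) ⟩
        b (r (b (b z)))
      ≡⟨ sym (band b bS _) ⟩
        b (c (b z))
      ≡⟨ cong (λ u → b (c u)) (sym (b≈sct z)) ⟩
        b (c (t (c (s z))))
      ≡⟨ sym (b≈sct _) ⟩
        t (c (s (c (t (c (s z))))))
      ≡⟨ band-sandwich s c t sS cS tS z ⟩
        t (c (s z))
      ≡⟨ b≈sct z ⟩
        b z
      ∎
      where
        open ≡-Reasoning
        bS = subset b Ib
        c  = (b ⨾ r) ⨾ b
        cS = closed _ b (closed b r bS rS) bS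
        b∈ScS = proj₂ (minimal⊆principal c cS b Ib)
        s   = proj₁ b∈ScS
        t   = proj₁ (proj₂ b∈ScS)
        sS  = proj₁ (proj₂ (proj₂ b∈ScS))
        tS  = proj₁ (proj₂ (proj₂ (proj₂ b∈ScS)))
        b≈sct = proj₂ (proj₂ (proj₂ (proj₂ b∈ScS)))

    -- Right multiplication by an element of S does not enlarge the kernel
    -- of an element of the minimal ideal: b = b r b recovers b from b r.
    kernel-of-minimal : ∀ b r → I b → InS S r →
                        ∀ v w → (b ⨾ r) v ≡ (b ⨾ r) w → b v ≡ b w
    kernel-of-minimal b r Ib rS v w e =
      begin
        b v           ≡⟨ sym (rectangular b r Ib rS v) ⟩
        b (r (b v))   ≡⟨ cong b e ⟩
        b (r (b w))   ≡⟨ rectangular b r Ib rS w ⟩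
        b w
      ∎
      where open ≡-Reasoning

    -- If bs generates I, any element of I collapsing v and w can be traced
    -- back (through its leftmost factor) to a generator collapsing them.
    collapse : (bs : List T) → (∀ f → I f ⇔ Generated bs f) →
               ∀ {h} → Generated bs h → ∀ v w → h v ≡ h w →
               Σ T λ b → b ∈ bs × b v ≡ b w
    collapse bs I⇔gen (gen {f} f∈bs) v w e = f , f∈bs , e
    collapse bs I⇔gen (resp {f} {g} f≈g gf) v w e =
      collapse bs I⇔gen gf v w (trans (f≈g v) (trans e (sym (f≈g w))))
    collapse bs I⇔gen (comp {f} {g} gf gg) v w e =
      collapse bs I⇔gen gf v w (kernel-of-minimal f g If gS v w e)
      where
        If = Equivalence.from (I⇔gen f) gf
        gS = subset g (Equivalence.from (I⇔gen g) gg)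

mainTheorem16 : (n : ℕ) (S : List (Transformation n)) →
    IsTransformationSemigroup S → IsBand S →
    (I : Transformation n → Set) → IsMinimalIdeal S I →
    (bs : List (Transformation n)) → (∀ f → I f ⇔ Generated bs f) →
    ∀ (v w : Fin n) → GrAdj (InS S) v w ⇔ GrAdj (λ f → f ∈ bs) v w
mainTheorem16 n S closed band I minimalIdeal bs I⇔gen v w = mk⇔ toGenerators toS
  where
    open BandFacts S closed band
    open MinimalIdeal I minimalIdeal
    open IsMinimalIdeal minimalIdeal
    open IsIdeal ideal

    generator∈S : ∀ {b} → b ∈ bs → InS S b
    generator∈S {b} b∈bs = subset b (Equivalence.from (I⇔gen b) (gen b∈bs))

    toGenerators : GrAdj (InS S) v w → GrAdj (λ f → f ∈ bs) v w
    toGenerators (v≢w , noS) = v≢w , λ (b , b∈bs , e) → noS (b , generator∈S b∈bs , e)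

    -- If f ∈ S collapses v, w then so does f e ∈ I, hence some generator.
    toS : GrAdj (λ f → f ∈ bs) v w → GrAdj (InS S) v w
    toS (v≢w , noGen) = v≢w , λ (f , fS , e) →
      let (m , Im) = nonempty
      in noGen (collapse bs I⇔gen (Equivalence.to (I⇔gen (f ⨾ m)) (closedˡ f m fS Im))
                         v w (cong m e))
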